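{- Let $\mathbb{K}$ be a field, let $N\ge 1$ and $s_1,\dots,s_r$ be nonnegative integers, and let \[ \mathcal{L}=\{(a_1,\dots,a_r)\in\mathbb{Z}^r:\ a_1s_1+\cdots+a_rs_r\equiv 0 \pmod N\}. \] Let $I_{\mathcal L}=\langle x^{\mathbf a^+}-x^{\mathbf a^- }:\ \mathbf a\in\mathcal L\rangle\subset \mathbb{K}[x_1,\dots,x_r]$ be the lattice ideal of $\mathcal L$. Then $I_{\mathcal L}$ equals the elimination ideal of the variable $t$ in the ideal \[ \widetilde I=\langle t^N-1,\ t^{s_1}-x_1,\ \dots,\ t^{s_r}-x_r\rangle\subset \mathbb{K}[t,x_1,\dots,x_r], \] that is, $I_{\mathcal L}=\widetilde I\cap \mathbb{K}[x_1,\dots,x_r]$.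
   Context: For $\mathbf a\in\mathbb{Z}^r$, $\mathbf a=\mathbf a^+-\mathbf a^-$ is the unique decomposition with $\mathbf a^+,\mathbf a^-\in\mathbb{N}^r$ having disjoint supports, and $x^{\mathbf b}=x_1^{b_1}\cdots x_r^{b_r}$. The ideal $I_{\mathcal L}$ is called the binomial ideal associated to the multi-loop network $C_N(s_1,\dots,s_r)$ (the directed graph on $\mathbb{Z}_N$ with arcs $i\to i+s_l \bmod N$). -}

module Defs where

open import Level using (Level; _⊔_)
open import Algebra.Bundles using (CommutativeRing)
open import Data.Nat as ℕ using (ℕ; zero; suc)
open import Data.Integer as ℤ using (ℤ; +_; -[1+_])
open import Data.Integer.Divisibility using () renaming (_∣_ to _∣ℤ_)
open import Data.Fin using (Fin)
open import Data.Vec as Vec using (Vec; []; _∷_; lookup; replicate; zipWith; updateAt)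
open import Data.Vec.Properties using (≡-dec)
open import Data.List as List using (List; []; _∷_; _++_; concatMap; map; foldr)
open import Data.Product using (Σ; ∃; ∃-syntax; _×_; _,_; proj₁)
open import Data.Sum using (_⊎_)
open import Relation.Nullary using (¬_; yes; no)
open import Relation.Binary.PropositionalEquality using (_≡_)

IsField : ∀ {c ℓ} → CommutativeRing c ℓ → Set (c ⊔ ℓ)
IsField K = (¬ (0# ≈ 1#)) × (∀ x → ¬ (x ≈ 0#) → ∃[ y ] (x * y ≈ 1#))
  where open CommutativeRing K

pos : ℤ → ℕ
pos (+ n)    = n
pos -[1+ n ] = 0

neg : ℤ → ℕ
neg (+ n)    = 0
neg -[1+ n ] = suc n

dotℤ : ∀ {r} → Vec ℤ r → Vec ℕ r → ℤ
dotℤ []       []       = + 0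
dotℤ (a ∷ as) (s ∷ ss) = a ℤ.* (+ s) ℤ.+ dotℤ as ss

InLattice : ∀ {r} → ℕ → Vec ℕ r → Vec ℤ r → Set
InLattice N s a = (+ N) ∣ℤ dotℤ a s

-- Polynomials over a commutative ring K in n variables, represented as finite
-- lists of terms (coefficient , exponent vector); two polynomials are equal
-- iff all their coefficients agree (setoid equality of K).
module Poly {c ℓ} (K : CommutativeRing c ℓ) where
  open CommutativeRing K

  Monomial : ℕ → Set
  Monomial n = Vec ℕ n

  Pol : ℕ → Set c
  Pol n = List (Carrier × Monomial n)

  coeff : ∀ {n} → Pol n → Monomial n → Carrier
  coeff []             m = 0#
  coeff ((a , e) ∷ p) m with ≡-dec ℕ._≟_ e m
  ... | yes _ = a + coeff p m
  ... | no  _ = coeff p m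

  _≈P_ : ∀ {n} → Pol n → Pol n → Set ℓ
  p ≈P q = ∀ m → coeff p m ≈ coeff q m

  0P : ∀ {n} → Pol n
  0P = []

  _+P_ : ∀ {n} → Pol n → Pol n → Pol n
  p +P q = p ++ q

  -P_ : ∀ {n} → Pol n → Pol n
  -P p = map (λ { (a , e) → (- a , e) }) p

  _-P_ : ∀ {n} → Pol n → Pol n → Pol n
  p -P q = p +P (-P q)

  _*P_ : ∀ {n} → Pol n → Pol n → Pol n
  p *P q = concatMap (λ { (a , e) → map (λ { (b , f) → (a * b , zipWith ℕ._+_ e f) }) q }) p

  mono : ∀ {n} → Monomial n → Pol n
  mono e = (1# , e) ∷ []

  1P : ∀ {n} → Pol n
  1P = mono (replicate _ 0)

  varPow : ∀ {n} → Fin n → ℕ → Pol n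
  varPow i k = mono (updateAt (replicate _ 0) i (λ _ → k))

  combo : ∀ {n} {g} {G : Pol n → Set g} → List (Pol n × Σ (Pol n) G) → Pol n
  combo = foldr (λ { (h , (g , _)) acc → (h *P g) +P acc }) 0P

  InIdeal : ∀ {n} {g} → (Pol n → Set g) → Pol n → Set (c ⊔ ℓ ⊔ g)
  InIdeal {n} G f = ∃[ cs ] (f ≈P combo {n} {G = G} cs)

  LatticeGen : ∀ {r} → ℕ → Vec ℕ r → Pol r → Set c
  LatticeGen N s g = ∃[ a ] (InLattice N s a × g ≡ (mono (Vec.map pos a) -P mono (Vec.map neg a)))

  -- Variables of K[t, x₁..x_r]: index zero is t, index (suc i) is x_{i+1}.
  -- Generators of Ĩ: t^N - 1 and t^{sᵢ} - xᵢ.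
  TildeGen : ∀ {r} → ℕ → Vec ℕ r → Pol (suc r) → Set c
  TildeGen {r} N s g =
    (g ≡ (varPow Fin.zero N -P 1P))
    ⊎ (∃[ i ] (g ≡ (varPow Fin.zero (lookup s i) -P varPow (Fin.suc i) 1)))
    where import Data.Fin as Fin

  embed : ∀ {r} → Pol r → Pol (suc r)
  embed = map (λ { (a , e) → (a , 0 ∷ e) })

module Submission where

-- Substituting xᵢ ↦ t^sᵢ sends t^k x^e to a power of t of degree k + e·s, and modulo Ĩ every
-- monomial is congruent to that power of t, with t^N ≡ 1. So monomials whose degrees agree
-- mod N are congruent modulo Ĩ; for a ∈ L this applies to x^a⁺ and x^a⁻, giving I_L ⊆ Ĩ.
-- Conversely, for each residue d the linear form summing the coefficients of all monomials
-- of degree ≡ d mod N vanishes on Ĩ. If f ∈ K[x] lies in Ĩ, replace every monomial of f by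
-- a fixed representative of its class; the difference lies in I_L, and the coefficient of the
-- result at a representative is a class sum of f, hence 0.

open import Defs
open import Algebra.Bundles using (CommutativeRing; CommutativeMonoid)
open import Level using (0ℓ; _⊔_)
open import Data.Nat as ℕ using (ℕ; zero; suc; _≤_)
import Data.Nat.Properties as ℕP
open import Data.Integer as ℤ using (ℤ; +_; -[1+_])
import Data.Integer.Properties as ℤP
import Data.Integer.Divisibility.Signed as ℤS
import Data.Nat.Divisibility as ℕD
open import Relation.Binary.Bundles using (DecSetoid)
import Relation.Binary.Construct.On as On
open import Data.Fin using (Fin) renaming (zero to fz; suc to fs)
open import Data.Vec as Vec using (Vec; []; _∷_; lookup; replicate; zipWith; updateAt)
open import Data.Vec.Properties using (≡-dec)
open import Data.List as List using (List; []; _∷_; _++_; map)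
open import Data.List.Properties using (map-++; ++-assoc; ++-identityʳ)
open import Data.List.Membership.Propositional using (_∈_)
open import Data.List.Membership.Propositional.Properties using (∈-map⁺; ∈-++⁺ˡ; ∈-++⁺ʳ; ∈-deduplicate⁺)
open import Data.List.Relation.Unary.Any as Any using (Any; here; there)
open import Data.List.Relation.Unary.All as All using (All; []; _∷_)
open import Data.List.Relation.Unary.Unique.Propositional using (Unique)
open import Data.List.Relation.Unary.Unique.DecPropositional.Properties using (deduplicate-!)
open import Data.List.Relation.Unary.AllPairs using ([]; _∷_)
open import Data.Product using (Σ; ∃-syntax; _×_; _,_; proj₂; map₂)
open import Data.Empty using (⊥-elim)
open import Data.Sum using (inj₁; inj₂)
open import Function.Base using (_∘_)
open import Function.Bundles using (_⇔_; mk⇔)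
open import Relation.Nullary using (¬_; Dec; yes; no)
import Relation.Nullary.Decidable as Dec
open import Relation.Binary.PropositionalEquality as ≡ using (_≡_; _≢_)

module ExponentArithmetic where
  open import Data.Nat using (_+_; _*_; _⊓_)

  infixl 6 _+ₑ_
  _+ₑ_ : ∀ {n} → Vec ℕ n → Vec ℕ n → Vec ℕ n
  _+ₑ_ = zipWith ℕ._+_

  zeros : ∀ {n} → Vec ℕ n
  zeros = replicate _ 0

  unit : ∀ {n} → Fin n → Vec ℕ n
  unit i = updateAt zeros i (λ _ → 1)

  increment : ∀ {n} → Vec ℕ n → Fin n → Vec ℕ n
  increment e i = updateAt e i suc

  dot : ∀ {n} → Vec ℕ n → Vec ℕ n → ℕ
  dot []      []      = 0
  dot (x ∷ e) (y ∷ s) = x * y + dot e s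

  +ₑ-zeros : ∀ {n} (e : Vec ℕ n) → e +ₑ zeros ≡ e
  +ₑ-zeros []      = ≡.refl
  +ₑ-zeros (x ∷ e) = ≡.cong₂ _∷_ (ℕP.+-identityʳ x) (+ₑ-zeros e)

  +ₑ-unit : ∀ {n} (e : Vec ℕ n) i → e +ₑ unit i ≡ increment e i
  +ₑ-unit (x ∷ e) fz     = ≡.cong₂ _∷_ (ℕP.+-comm x 1) (+ₑ-zeros e)
  +ₑ-unit (x ∷ e) (fs i) = ≡.cong₂ _∷_ (ℕP.+-identityʳ x) (+ₑ-unit e i)

  dot-zeros : ∀ {n} (s : Vec ℕ n) → dot zeros s ≡ 0
  dot-zeros []      = ≡.refl
  dot-zeros (x ∷ s) = dot-zeros s

  dot-+ₑ : ∀ {n} (e f s : Vec ℕ n) → dot (e +ₑ f) s ≡ dot e s + dot f s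
  dot-+ₑ []      []      []      = ≡.refl
  dot-+ₑ (x ∷ e) (y ∷ f) (z ∷ s) =
    ≡.trans (≡.cong₂ _+_ (ℕP.*-distribʳ-+ z x y) (dot-+ₑ e f s)) (+-interchange (x * z) (y * z) _ _)
    where open import Algebra.Properties.CommutativeSemigroup ℕP.+-commutativeSemigroup
            renaming (interchange to +-interchange)

  dot-unit : ∀ {n} i (s : Vec ℕ n) → dot (unit i) s ≡ lookup s i
  dot-unit fz     (x ∷ s) = ≡.trans (≡.cong₂ _+_ (ℕP.*-identityˡ x) (dot-zeros s)) (ℕP.+-identityʳ x)
  dot-unit (fs i) (x ∷ s) = dot-unit i s

  dot-increment : ∀ {n} (e : Vec ℕ n) i s → dot (increment e i) s ≡ lookup s i + dot e s
  dot-increment (x ∷ e) fz     (y ∷ s) = ℕP.+-assoc y (x * y) (dot e s)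
  dot-increment (x ∷ e) (fs i) (y ∷ s) = begin
    x * y + dot (increment e i) s   ≡⟨ ≡.cong (λ z → x * y + z) (dot-increment e i s) ⟩
    x * y + (lookup s i + dot e s)  ≡⟨ ℕP.+-assoc (x * y) _ _ ⟨
    x * y + lookup s i + dot e s    ≡⟨ ≡.cong (_+ dot e s) (ℕP.+-comm (x * y) _) ⟩
    lookup s i + x * y + dot e s    ≡⟨ ℕP.+-assoc (lookup s i) _ _ ⟩
    lookup s i + (x * y + dot e s)  ∎
    where open ≡.≡-Reasoning

  data Increments {n} : Vec ℕ n → Set where
    none : Increments zeros
    more : ∀ {e} → Increments e → ∀ i → Increments (increment e i)

  increments : ∀ {n} (e : Vec ℕ n) → Increments e
  increments []      = none
  increments (x ∷ e) = prepend x (increments e)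
    where
    prepend0 : ∀ {n} {e : Vec ℕ n} → Increments e → Increments (0 ∷ e)
    prepend0 none       = none
    prepend0 (more p i) = more (prepend0 p) (fs i)
    prepend : ∀ {n} x {e : Vec ℕ n} → Increments e → Increments (x ∷ e)
    prepend zero    p = prepend0 p
    prepend (suc x) p = more (prepend x p) fz

  ℤ-pos-neg : ∀ a → a ≡ + pos a ℤ.- + neg a
  ℤ-pos-neg (+ n)    = ≡.sym (ℤP.+-identityʳ (+ n))
  ℤ-pos-neg -[1+ n ] = ≡.refl

  dotℤ-pos-neg : ∀ {n} (a : Vec ℤ n) s → dotℤ a s ≡ + dot (Vec.map pos a) s ℤ.- + dot (Vec.map neg a) s
  dotℤ-pos-neg []      []      = ≡.refl
  dotℤ-pos-neg (a ∷ as) (y ∷ s) = begin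
    a ℤ.* + y ℤ.+ dotℤ as s
      ≡⟨ ≡.cong₂ (λ u v → u ℤ.* + y ℤ.+ v) (ℤ-pos-neg a) (dotℤ-pos-neg as s) ⟩
    (+ pos a ℤ.- + neg a) ℤ.* + y ℤ.+ (+ P ℤ.- + Q)
      ≡⟨ regroup (+ pos a) (+ neg a) (+ y) (+ P) (+ Q) ⟩
    (+ pos a ℤ.* + y ℤ.+ + P) ℤ.- (+ neg a ℤ.* + y ℤ.+ + Q)
      ≡⟨ ≡.cong₂ (λ u v → u ℤ.- v) (toℕ (pos a)) (toℕ (neg a)) ⟩
    + (pos a * y + P) ℤ.- + (neg a * y + Q) ∎
    where
    open ≡.≡-Reasoning
    open import Data.Integer.Solver using (module +-*-Solver)
    open +-*-Solver
    P = dot (Vec.map pos as) s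
    Q = dot (Vec.map neg as) s
    regroup : ∀ p q y u v → (p ℤ.- q) ℤ.* y ℤ.+ (u ℤ.- v) ≡ (p ℤ.* y ℤ.+ u) ℤ.- (q ℤ.* y ℤ.+ v)
    regroup = solve 5 (λ p q y u v → (p :- q) :* y :+ (u :- v) := (p :* y :+ u) :- (q :* y :+ v)) ≡.refl
    toℕ : ∀ x {z} → + x ℤ.* + y ℤ.+ + z ≡ + (x * y + z)
    toℕ x {z} = ≡.trans (≡.cong (ℤ._+ + z) (≡.sym (ℤP.pos-* x y))) (≡.sym (ℤP.pos-+ (x * y) z))

  signedDiff : ℕ → ℕ → ℤ
  signedDiff zero    zero    = + 0
  signedDiff zero    (suc b) = -[1+ b ]
  signedDiff (suc a) zero    = + suc a
  signedDiff (suc a) (suc b) = signedDiff a b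

  ⊓-+-pos-signedDiff : ∀ a b → a ⊓ b + pos (signedDiff a b) ≡ a
  ⊓-+-pos-signedDiff zero    zero    = ≡.refl
  ⊓-+-pos-signedDiff zero    (suc b) = ≡.refl
  ⊓-+-pos-signedDiff (suc a) zero    = ≡.refl
  ⊓-+-pos-signedDiff (suc a) (suc b) = ≡.cong suc (⊓-+-pos-signedDiff a b)

  ⊓-+-neg-signedDiff : ∀ a b → a ⊓ b + neg (signedDiff a b) ≡ b
  ⊓-+-neg-signedDiff zero    zero    = ≡.refl
  ⊓-+-neg-signedDiff zero    (suc b) = ≡.refl
  ⊓-+-neg-signedDiff (suc a) zero    = ≡.refl
  ⊓-+-neg-signedDiff (suc a) (suc b) = ≡.cong suc (⊓-+-neg-signedDiff a b)

  gcdₑ : ∀ {n} → Vec ℕ n → Vec ℕ n → Vec ℕ n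
  gcdₑ = zipWith _⊓_

  diffₑ : ∀ {n} → Vec ℕ n → Vec ℕ n → Vec ℤ n
  diffₑ = zipWith signedDiff

  gcdₑ-+ₑ-pos : ∀ {n} (e f : Vec ℕ n) → gcdₑ e f +ₑ Vec.map pos (diffₑ e f) ≡ e
  gcdₑ-+ₑ-pos []      []      = ≡.refl
  gcdₑ-+ₑ-pos (a ∷ e) (b ∷ f) = ≡.cong₂ _∷_ (⊓-+-pos-signedDiff a b) (gcdₑ-+ₑ-pos e f)

  gcdₑ-+ₑ-neg : ∀ {n} (e f : Vec ℕ n) → gcdₑ e f +ₑ Vec.map neg (diffₑ e f) ≡ f
  gcdₑ-+ₑ-neg []      []      = ≡.refl
  gcdₑ-+ₑ-neg (a ∷ e) (b ∷ f) = ≡.cong₂ _∷_ (⊓-+-neg-signedDiff a b) (gcdₑ-+ₑ-neg e f)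

  dotℤ-diffₑ : ∀ {n} (e f s : Vec ℕ n) → dotℤ (diffₑ e f) s ≡ + dot e s ℤ.- + dot f s
  dotℤ-diffₑ e f s = begin
    dotℤ (diffₑ e f) s                         ≡⟨ dotℤ-pos-neg (diffₑ e f) s ⟩
    + dot P s ℤ.- + dot Q s                    ≡⟨ cancel (+ dot G s) (+ dot P s) (+ dot Q s) ⟩
    (+ dot G s ℤ.+ + dot P s) ℤ.- (+ dot G s ℤ.+ + dot Q s)
      ≡⟨ ≡.cong₂ ℤ._-_ (dotℕ≡ P (gcdₑ-+ₑ-pos e f)) (dotℕ≡ Q (gcdₑ-+ₑ-neg e f)) ⟩
    + dot e s ℤ.- + dot f s                    ∎
    where
    open ≡.≡-Reasoning
    open import Data.Integer.Solver using (module +-*-Solver)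
    open +-*-Solver
    G = gcdₑ e f
    P = Vec.map pos (diffₑ e f)
    Q = Vec.map neg (diffₑ e f)
    cancel : ∀ g p q → p ℤ.- q ≡ (g ℤ.+ p) ℤ.- (g ℤ.+ q)
    cancel = solve 3 (λ g p q → p :- q := (g :+ p) :- (g :+ q)) ≡.refl
    dotℕ≡ : ∀ R {h} → G +ₑ R ≡ h → + dot G s ℤ.+ + dot R s ≡ + dot h s
    dotℕ≡ R ≡.refl = ≡.trans (≡.sym (ℤP.pos-+ (dot G s) (dot R s))) (≡.cong +_ (≡.sym (dot-+ₑ G R s)))

open ExponentArithmetic

module ModularCongruence (N : ℕ) where
  open import Data.Integer.Solver using (module +-*-Solver)
  open +-*-Solver

  infix 4 _≋_
  record _≋_ (x y : ℕ) : Set where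
    constructor mk≋
    field N∣x-y : + N ℤS.∣ + x ℤ.- + y
  open _≋_ public

  ≋-refl : ∀ {x} → x ≋ x
  ≋-refl {x} = mk≋ (≡.subst (+ N ℤS.∣_) (≡.sym (ℤP.+-inverseʳ (+ x))) (ℤS.divides (+ 0) ≡.refl))

  ≋-sym : ∀ {x y} → x ≋ y → y ≋ x
  ≋-sym {x} {y} (mk≋ x≋y) = mk≋ (≡.subst (+ N ℤS.∣_) (flip (+ x) (+ y)) (ℤS.∣m⇒∣-m x≋y))
    where
    flip : ∀ a b → ℤ.- (a ℤ.- b) ≡ b ℤ.- a
    flip = solve 2 (λ a b → :- (a :- b) := b :- a) ≡.refl

  ≋-trans : ∀ {x y z} → x ≋ y → y ≋ z → x ≋ z
  ≋-trans {x} {y} {z} (mk≋ x≋y) (mk≋ y≋z) =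
    mk≋ (≡.subst (+ N ℤS.∣_) (telescope (+ x) (+ y) (+ z)) (ℤS.∣m∣n⇒∣m+n x≋y y≋z))
    where
    telescope : ∀ a b c → (a ℤ.- b) ℤ.+ (b ℤ.- c) ≡ a ℤ.- c
    telescope = solve 3 (λ a b c → (a :- b) :+ (b :- c) := a :- c) ≡.refl

  _≋?_ : ∀ x y → Dec (x ≋ y)
  x ≋? y = Dec.map′ mk≋ N∣x-y (+ N ℤS.∣? + x ℤ.- + y)

  ≋-decSetoid : DecSetoid 0ℓ 0ℓ
  ≋-decSetoid = record
    { isDecEquivalence = record
      { isEquivalence = record { refl = ≋-refl ; sym = ≋-sym ; trans = ≋-trans }
      ; _≟_ = _≋?_
      }
    }

  +-congˡ-≋ : ∀ k {x y} → x ≋ y → k ℕ.+ x ≋ k ℕ.+ y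
  +-congˡ-≋ k {x} {y} (mk≋ x≋y) = mk≋ (≡.subst (+ N ℤS.∣_) (≡.sym k+x-[k+y]≡x-y) x≋y)
    where
    cancel : ∀ c a b → (c ℤ.+ a) ℤ.- (c ℤ.+ b) ≡ a ℤ.- b
    cancel = solve 3 (λ c a b → (c :+ a) :- (c :+ b) := a :- b) ≡.refl
    k+x-[k+y]≡x-y : + (k ℕ.+ x) ℤ.- + (k ℕ.+ y) ≡ + x ℤ.- + y
    k+x-[k+y]≡x-y = ≡.trans (≡.cong₂ ℤ._-_ (ℤP.pos-+ k x) (ℤP.pos-+ k y)) (cancel (+ k) (+ x) (+ y))

  ≋-reflexive : ∀ {x y} → x ≡ y → x ≋ y
  ≋-reflexive ≡.refl = ≋-refl

  N+-≋ : ∀ x → N ℕ.+ x ≋ x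
  N+-≋ x = mk≋ (≡.subst (+ N ℤS.∣_) (≡.sym N+x-x≡N) ℤS.∣-refl)
    where
    cancel : ∀ n a → (n ℤ.+ a) ℤ.- a ≡ n
    cancel = solve 2 (λ n a → (n :+ a) :- a := n) ≡.refl
    N+x-x≡N : + (N ℕ.+ x) ℤ.- + x ≡ + N
    N+x-x≡N = ≡.trans (≡.cong (ℤ._- + x) (ℤP.pos-+ N x)) (cancel (+ N) (+ x))

  ≋⇒≡+*N : ∀ {x y} → y ≤ x → x ≋ y → ∃[ q ] x ≡ y ℕ.+ q ℕ.* N
  ≋⇒≡+*N {x} {y} y≤x (mk≋ x≋y) with ℤS.∣⇒∣ᵤ x≋y
  ... | ℕD.divides q x-y≡q*N = q , (begin
    x                        ≡⟨ ℕP.m+[n∸m]≡n y≤x ⟨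
    y ℕ.+ (x ℕ.∸ y)          ≡⟨ ≡.cong (y ℕ.+_) ∣x-y∣≡x∸y ⟨
    y ℕ.+ ℤ.∣ + x ℤ.- + y ∣  ≡⟨ ≡.cong (y ℕ.+_) x-y≡q*N ⟩
    y ℕ.+ q ℕ.* N            ∎)
    where
    open ≡.≡-Reasoning
    ∣x-y∣≡x∸y : ℤ.∣ + x ℤ.- + y ∣ ≡ x ℕ.∸ y
    ∣x-y∣≡x∸y = ≡.cong ℤ.∣_∣ (≡.trans (ℤP.m-n≡m⊖n x y) (ℤP.⊖-≥ y≤x))

module Representatives {a ℓ′} (S : DecSetoid a ℓ′) where
  open DecSetoid S

  rep : List Carrier → Carrier → Carrier
  rep []      x = x
  rep (y ∷ L) x with x ≟ y
  ... | yes _ = y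
  ... | no  _ = rep L x

  rep-≈ : ∀ L x → x ≈ rep L x
  rep-≈ []      x = refl
  rep-≈ (y ∷ L) x with x ≟ y
  ... | yes x≈y = x≈y
  ... | no  _   = rep-≈ L x

  rep-resp : ∀ L {x y} → Any (x ≈_) L → x ≈ y → rep L x ≡ rep L y
  rep-resp (z ∷ L) {x} {y} x∈L x≈y with x ≟ z | y ≟ z
  ... | yes _   | yes _   = ≡.refl
  ... | yes x≈z | no  y≉z = ⊥-elim (y≉z (trans (sym x≈y) x≈z))
  ... | no  x≉z | yes y≈z = ⊥-elim (x≉z (trans x≈y y≈z))
  ... | no  x≉z | no  _   with x∈L
  ...   | here  x≈z  = ⊥-elim (x≉z x≈z)
  ...   | there x∈L′ = rep-resp L x∈L′ x≈y

module PolynomialAlgebra {c ℓ} (K : CommutativeRing c ℓ) where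
  open CommutativeRing K
  open Poly K
  open import Relation.Binary.Reasoning.Setoid setoid
  open import Algebra.Properties.Ring ring using (-‿distribˡ-*; -‿distribʳ-*)

  infix 4 _≟ₘ_
  _≟ₘ_ : ∀ {n} (e f : Monomial n) → Dec (e ≡ f)
  _≟ₘ_ = ≡-dec ℕ._≟_

  𝟙 : ∀ {p} {P : Set p} → Dec P → Carrier
  𝟙 (yes _) = 1#
  𝟙 (no _)  = 0#

  𝟙-yes : ∀ {p} {P : Set p} (d : Dec P) → P → 𝟙 d ≈ 1#
  𝟙-yes (yes _) _ = refl
  𝟙-yes (no ¬p) p = ⊥-elim (¬p p)

  𝟙-no : ∀ {p} {P : Set p} (d : Dec P) → ¬ P → 𝟙 d ≈ 0#
  𝟙-no (yes p) ¬p = ⊥-elim (¬p p)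
  𝟙-no (no _)  _  = refl

  𝟙-cong : ∀ {p q} {P : Set p} {Q : Set q} (d : Dec P) (d′ : Dec Q) →
           (P → Q) → (Q → P) → 𝟙 d ≈ 𝟙 d′
  𝟙-cong (yes _) (yes _) _   _   = refl
  𝟙-cong (yes p) (no ¬q) p⇒q _   = ⊥-elim (¬q (p⇒q p))
  𝟙-cong (no ¬p) (yes q) _   q⇒p = ⊥-elim (¬p (q⇒p q))
  𝟙-cong (no _)  (no _)  _   _   = refl

  weightedSum : ∀ {n} → (Monomial n → Carrier) → Pol n → Carrier
  weightedSum w []            = 0#
  weightedSum w ((a , e) ∷ p) = a * w e + weightedSum w p

  coeff≈weightedSum : ∀ {n} (p : Pol n) m → coeff p m ≈ weightedSum (λ e → 𝟙 (e ≟ₘ m)) p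
  coeff≈weightedSum []            m = refl
  coeff≈weightedSum ((a , e) ∷ p) m with e ≟ₘ m
  ... | yes _ = +-cong (sym (*-identityʳ a)) (coeff≈weightedSum p m)
  ... | no  _ = begin
    coeff p m                    ≈⟨ coeff≈weightedSum p m ⟩
    weightedSum _ p              ≈⟨ +-identityˡ _ ⟨
    0# + weightedSum _ p         ≈⟨ +-congʳ (zeroʳ a) ⟨
    a * 0# + weightedSum _ p     ∎

  weightedSum-++ : ∀ {n} w (p q : Pol n) → weightedSum w (p ++ q) ≈ weightedSum w p + weightedSum w q
  weightedSum-++ w []            q = sym (+-identityˡ _)
  weightedSum-++ w ((a , e) ∷ p) q = trans (+-congˡ (weightedSum-++ w p q)) (sym (+-assoc _ _ _))

  weightedSum-congˡ : ∀ {n} {w w′ : Monomial n → Carrier} (p : Pol n) →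
                      All (λ t → w (proj₂ t) ≈ w′ (proj₂ t)) p → weightedSum w p ≈ weightedSum w′ p
  weightedSum-congˡ []      []          = refl
  weightedSum-congˡ (_ ∷ p) (eq ∷ eqs) = +-cong (*-congˡ eq) (weightedSum-congˡ p eqs)

  weightedSum-zero : ∀ {n} (p : Pol n) → weightedSum (λ _ → 0#) p ≈ 0#
  weightedSum-zero []            = refl
  weightedSum-zero ((a , e) ∷ p) = trans (+-cong (zeroʳ a) (weightedSum-zero p)) (+-identityˡ 0#)

  sumOver : ∀ {a} {A : Set a} → List A → (A → Carrier) → Carrier
  sumOver []      f = 0#
  sumOver (x ∷ D) f = f x + sumOver D f

  syntax sumOver D (λ m → f) = ∑[ m ∈ D ] f

  sumOver-cong : ∀ {a} {A : Set a} (D : List A) {f g : A → Carrier} → (∀ m → f m ≈ g m) →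
                 ∑[ m ∈ D ] f m ≈ ∑[ m ∈ D ] g m
  sumOver-cong []      eq = refl
  sumOver-cong (x ∷ D) eq = +-cong (eq x) (sumOver-cong D eq)

  sumOver-zero : ∀ {a} {A : Set a} (D : List A) {f : A → Carrier} → All (λ m → f m ≈ 0#) D →
                 ∑[ m ∈ D ] f m ≈ 0#
  sumOver-zero []      []         = refl
  sumOver-zero (x ∷ D) (z ∷ zs) = trans (+-cong z (sumOver-zero D zs)) (+-identityˡ 0#)

  sumOver-+ : ∀ {a} {A : Set a} (D : List A) (f g : A → Carrier) →
              ∑[ m ∈ D ] (f m + g m) ≈ ∑[ m ∈ D ] f m + ∑[ m ∈ D ] g m
  sumOver-+ []      f g = sym (+-identityˡ 0#)
  sumOver-+ (x ∷ D) f g = trans (+-congˡ (sumOver-+ D f g)) (interchange _ _ _ _)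
    where open import Algebra.Properties.CommutativeSemigroup +-commutativeSemigroup using (interchange)

  coeff-∷ : ∀ {n} a (e : Monomial n) p m → coeff ((a , e) ∷ p) m ≈ a * 𝟙 (e ≟ₘ m) + coeff p m
  coeff-∷ a e p m = trans (coeff≈weightedSum ((a , e) ∷ p) m) (+-congˡ (sym (coeff≈weightedSum p m)))

  indicator-off : ∀ {n} {e m : Monomial n} a (w : Monomial n → Carrier) → e ≢ m →
                  a * 𝟙 (e ≟ₘ m) * w m ≈ 0#
  indicator-off {e = e} {m} a w e≢m =
    trans (*-congʳ (trans (*-congˡ (𝟙-no (e ≟ₘ m) e≢m)) (zeroʳ a))) (zeroˡ (w m))

  sumOver-indicator : ∀ {n} (e : Monomial n) a (w : Monomial n → Carrier) {D} → Unique D → e ∈ D →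
                      ∑[ m ∈ D ] (a * 𝟙 (e ≟ₘ m) * w m) ≈ a * w e
  sumOver-indicator e a w {m ∷ D} (m∉D ∷ _) (here ≡.refl) = begin
    a * 𝟙 (m ≟ₘ m) * w m + _  ≈⟨ +-cong (*-congʳ (*-congˡ (𝟙-yes (m ≟ₘ m) ≡.refl)))
                                    (sumOver-zero D (All.map (indicator-off a w) m∉D)) ⟩
    a * 1# * w m + 0#         ≈⟨ +-identityʳ _ ⟩
    a * 1# * w m              ≈⟨ *-congʳ (*-identityʳ a) ⟩
    a * w m                   ∎
  sumOver-indicator e a w {m ∷ D} (m∉D ∷ D!) (there e∈D) = begin
    a * 𝟙 (e ≟ₘ m) * w m + _  ≈⟨ +-cong (indicator-off a w (λ e≡m → All.lookup m∉D e∈D (≡.sym e≡m)))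
                                    (sumOver-indicator e a w D! e∈D) ⟩
    0# + a * w e              ≈⟨ +-identityˡ _ ⟩
    a * w e                   ∎

  exponents : ∀ {n} → Pol n → List (Monomial n)
  exponents = map proj₂

  weightedSum≈sumOver : ∀ {n} (w : Monomial n → Carrier) (p : Pol n) {D} → Unique D →
                        All (λ t → proj₂ t ∈ D) p → weightedSum w p ≈ ∑[ m ∈ D ] (coeff p m * w m)
  weightedSum≈sumOver w [] {D} D! [] =
    sym (sumOver-zero D (All.tabulate (λ {m} _ → zeroˡ (w m))))
  weightedSum≈sumOver w ((a , e) ∷ p) {D} D! (e∈D ∷ p⊆D) = begin
    a * w e + weightedSum w p
      ≈⟨ +-cong (sym (sumOver-indicator e a w D! e∈D)) (weightedSum≈sumOver w p D! p⊆D) ⟩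
    ∑[ m ∈ D ] (a * 𝟙 (e ≟ₘ m) * w m) + ∑[ m ∈ D ] (coeff p m * w m)
      ≈⟨ sumOver-+ D _ _ ⟨
    ∑[ m ∈ D ] (a * 𝟙 (e ≟ₘ m) * w m + coeff p m * w m)
      ≈⟨ sumOver-cong D (λ m → trans (sym (distribʳ (w m) _ _)) (*-congʳ (sym (coeff-∷ a e p m)))) ⟩
    ∑[ m ∈ D ] (coeff ((a , e) ∷ p) m * w m) ∎

  -- Sum both sides over their common support.
  weightedSum-resp-≈P : ∀ {n} (w : Monomial n → Carrier) {p q : Pol n} → p ≈P q →
                        weightedSum w p ≈ weightedSum w q
  weightedSum-resp-≈P w {p} {q} p≈q = begin
    weightedSum w p               ≈⟨ weightedSum≈sumOver w p D! (All.tabulate (inD ∘ ∈-++⁺ˡ ∘ exp∈)) ⟩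
    ∑[ m ∈ D ] (coeff p m * w m)  ≈⟨ sumOver-cong D (λ m → *-congʳ (p≈q m)) ⟩
    ∑[ m ∈ D ] (coeff q m * w m)  ≈⟨ weightedSum≈sumOver w q D! (All.tabulate (inD ∘ ∈-++⁺ʳ _ ∘ exp∈)) ⟨
    weightedSum w q               ∎
    where
    D = List.deduplicate _≟ₘ_ (exponents p ++ exponents q)
    D! = deduplicate-! _≟ₘ_ (exponents p ++ exponents q)
    inD = ∈-deduplicate⁺ _≟ₘ_
    exp∈ : ∀ {r : Pol _} {t} → t ∈ r → proj₂ t ∈ exponents r
    exp∈ = ∈-map⁺ proj₂

  coeff-++ : ∀ {n} (p q : Pol n) m → coeff (p ++ q) m ≈ coeff p m + coeff q m
  coeff-++ p q m = begin
    coeff (p ++ q) m                    ≈⟨ coeff≈weightedSum (p ++ q) m ⟩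
    weightedSum _ (p ++ q)              ≈⟨ weightedSum-++ _ p q ⟩
    weightedSum _ p + weightedSum _ q   ≈⟨ +-cong (coeff≈weightedSum p m) (coeff≈weightedSum q m) ⟨
    coeff p m + coeff q m               ∎

  ≡⇒≈P : ∀ {n} {p q : Pol n} → p ≡ q → p ≈P q
  ≡⇒≈P ≡.refl m = refl

  ++-congP : ∀ {n} (p p′ q q′ : Pol n) → p ≈P p′ → q ≈P q′ → (p ++ q) ≈P (p′ ++ q′)
  ++-congP p p′ q q′ p≈p′ q≈q′ m = begin
    coeff (p ++ q) m         ≈⟨ coeff-++ p q m ⟩
    coeff p m + coeff q m    ≈⟨ +-cong (p≈p′ m) (q≈q′ m) ⟩
    coeff p′ m + coeff q′ m  ≈⟨ coeff-++ p′ q′ m ⟨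
    coeff (p′ ++ q′) m       ∎

  ++-commutativeMonoid : ℕ → CommutativeMonoid c ℓ
  ++-commutativeMonoid n = record
    { Carrier = Pol n
    ; _≈_ = _≈P_
    ; _∙_ = _++_
    ; ε = []
    ; isCommutativeMonoid = record
      { isMonoid = record
        { isSemigroup = record
          { isMagma = record
            { isEquivalence = record
              { refl = λ m → refl ; sym = λ eq m → sym (eq m) ; trans = λ eq eq′ m → trans (eq m) (eq′ m) }
            ; ∙-cong = λ {p} {p′} {q} {q′} → ++-congP p p′ q q′
            }
          ; assoc = λ p q r → ≡⇒≈P (++-assoc p q r)
          }
        ; identity = (λ p m → refl) , (λ p → ≡⇒≈P (++-identityʳ p))
        }
      ; comm = λ p q m → begin
          coeff (p ++ q) m       ≈⟨ coeff-++ p q m ⟩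
          coeff p m + coeff q m  ≈⟨ +-comm _ _ ⟩
          coeff q m + coeff p m  ≈⟨ coeff-++ q p m ⟨
          coeff (q ++ p) m       ∎
      }
    }

  ≈P-by-weightedSum : ∀ {n} (p q : Pol n) → (∀ w → weightedSum w p ≈ weightedSum w q) → p ≈P q
  ≈P-by-weightedSum p q eq m =
    trans (coeff≈weightedSum p m) (trans (eq _) (sym (coeff≈weightedSum q m)))

  renameexponents : ∀ {n n′} → (Monomial n → Monomial n′) → Pol n → Pol n′
  renameexponents g = map (map₂ g)

  weightedSum-renameexponents : ∀ {n n′} (w : Monomial n′ → Carrier) (g : Monomial n → Monomial n′) p →
                                weightedSum w (renameexponents g p) ≡ weightedSum (w ∘ g) p
  weightedSum-renameexponents w g []            = ≡.refl
  weightedSum-renameexponents w g ((a , e) ∷ p) = ≡.cong (λ z → a * w (g e) + z) (weightedSum-renameexponents w g p)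

  renameexponents-resp-≈P : ∀ {n n′} (g : Monomial n → Monomial n′) {p q : Pol n} → p ≈P q →
                            renameexponents g p ≈P renameexponents g q
  renameexponents-resp-≈P g {p} {q} p≈q = ≈P-by-weightedSum (renameexponents g p) (renameexponents g q) λ w → begin
    weightedSum w (renameexponents g p)  ≡⟨ weightedSum-renameexponents w g p ⟩
    weightedSum (w ∘ g) p                ≈⟨ weightedSum-resp-≈P (w ∘ g) {p} {q} p≈q ⟩
    weightedSum (w ∘ g) q                ≡⟨ weightedSum-renameexponents w g q ⟨
    weightedSum w (renameexponents g q)  ∎

  binomial : ∀ {n} → Carrier → Monomial n → Monomial n → Pol n
  binomial a E F = (a , E) ∷ (- a , F) ∷ []

  weightedSum-binomial : ∀ {n} w a (E F : Monomial n) → weightedSum w (binomial a E F) ≈ a * w E - a * w F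
  weightedSum-binomial w a E F = +-congˡ (trans (+-identityʳ _) (sym (-‿distribˡ-* a (w F))))

  binomial-congˡ : ∀ {n} {a a′} {E F : Monomial n} → a ≈ a′ → binomial a E F ≈P binomial a′ E F
  binomial-congˡ {a = a} {a′} {E} {F} a≈a′ = ≈P-by-weightedSum (binomial a E F) (binomial a′ E F)
    λ w → +-cong (*-congʳ a≈a′) (+-congʳ (*-congʳ (-‿cong a≈a′)))

  binomial-refl : ∀ {n} a (E : Monomial n) → binomial a E E ≈P []
  binomial-refl a E = ≈P-by-weightedSum (binomial a E E) [] λ w → trans (weightedSum-binomial w a E E) (-‿inverseʳ _)

  binomial-trans : ∀ {n} a (E F G : Monomial n) → binomial a E G ≈P (binomial a E F ++ binomial a F G)
  binomial-trans a E F G = ≈P-by-weightedSum (binomial a E G) (binomial a E F ++ binomial a F G) λ w → begin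
    weightedSum w (binomial a E G)                     ≈⟨ weightedSum-binomial w a E G ⟩
    a * w E - a * w G                                  ≈⟨ +-congˡ (+-identityˡ _) ⟨
    a * w E + (0# - a * w G)                           ≈⟨ +-congˡ (+-congʳ (-‿inverseˡ _)) ⟨
    a * w E + ((- (a * w F) + a * w F) - a * w G)      ≈⟨ +-congˡ (+-assoc _ _ _) ⟩
    a * w E + (- (a * w F) + (a * w F - a * w G))      ≈⟨ +-assoc _ _ _ ⟨
    (a * w E - a * w F) + (a * w F - a * w G)          ≈⟨ +-cong (weightedSum-binomial w a E F)
                                                                 (weightedSum-binomial w a F G) ⟨
    weightedSum w (binomial a E F) + weightedSum w (binomial a F G)
                                                       ≈⟨ weightedSum-++ w (binomial a E F) (binomial a F G) ⟨
    weightedSum w (binomial a E F ++ binomial a F G)   ∎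

  binomial-swap : ∀ {n} a (E F : Monomial n) → binomial a F E ≈P binomial (- a) E F
  binomial-swap a E F = ≈P-by-weightedSum (binomial a F E) (binomial (- a) E F) λ w → begin
    weightedSum w (binomial a F E)            ≈⟨ weightedSum-binomial w a F E ⟩
    a * w F - a * w E                         ≈⟨ +-comm _ _ ⟩
    - (a * w E) + a * w F                     ≈⟨ +-cong (-‿distribˡ-* a (w E)) (sym (⁻¹-involutive _)) ⟩
    - a * w E - - (a * w F)                   ≈⟨ +-congˡ (-‿cong (-‿distribˡ-* a (w F))) ⟩
    - a * w E - - a * w F                     ≈⟨ weightedSum-binomial w (- a) E F ⟨
    weightedSum w (binomial (- a) E F)        ∎
    where open import Algebra.Properties.Group +-group using (⁻¹-involutive)

  term≈binomial+term : ∀ {n} a (E F : Monomial n) → ((a , E) ∷ []) ≈P (binomial a E F ++ ((a , F) ∷ []))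
  term≈binomial+term a E F = ≈P-by-weightedSum ((a , E) ∷ []) (binomial a E F ++ ((a , F) ∷ [])) λ w → begin
    a * w E + 0#                                      ≈⟨ +-congˡ (-‿inverseˡ _) ⟨
    a * w E + (- (a * w F) + a * w F)                 ≈⟨ +-assoc _ _ _ ⟨
    a * w E - a * w F + a * w F                       ≈⟨ +-cong (weightedSum-binomial w a E F) (+-identityʳ _) ⟨
    weightedSum w (binomial a E F) + (a * w F + 0#)   ≈⟨ weightedSum-++ w (binomial a E F) ((a , F) ∷ []) ⟨
    weightedSum w (binomial a E F ++ ((a , F) ∷ []))  ∎

  -- ((b , e) ∷ h) *P p reduces definitionally to shift b e p ++ (h *P p).
  shift : ∀ {n} → Carrier → Monomial n → Pol n → Pol n
  shift b e = map (λ { (a , f) → (b * a , e +ₑ f) })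

  weightedSum-shift : ∀ {n} w b (e : Monomial n) p →
                      weightedSum w (shift b e p) ≈ b * weightedSum (λ f → w (e +ₑ f)) p
  weightedSum-shift w b e []            = sym (zeroʳ b)
  weightedSum-shift w b e ((a , f) ∷ p) = begin
    b * a * w (e +ₑ f) + weightedSum w (shift b e p)   ≈⟨ +-cong (*-assoc b a _) (weightedSum-shift w b e p) ⟩
    b * (a * w (e +ₑ f)) + b * weightedSum _ p         ≈⟨ distribˡ b _ _ ⟨
    b * (a * w (e +ₑ f) + weightedSum _ p)             ∎

  shift-binomial : ∀ {n} b a (e E F : Monomial n) → shift b e (binomial a E F) ≈P binomial (b * a) (e +ₑ E) (e +ₑ F)
  shift-binomial b a e E F = ≈P-by-weightedSum (shift b e (binomial a E F)) (binomial (b * a) (e +ₑ E) (e +ₑ F))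
    λ w → +-congˡ (+-congʳ (*-congʳ (sym (-‿distribʳ-* b a))))

  weightedSum-*P-vanishes : ∀ {n} w (g : Pol n) → (∀ e → weightedSum (λ f → w (e +ₑ f)) g ≈ 0#) →
                            ∀ h → weightedSum w (h *P g) ≈ 0#
  weightedSum-*P-vanishes w g g⊥ []            = refl
  weightedSum-*P-vanishes w g g⊥ ((b , e) ∷ h) = begin
    weightedSum w (shift b e g ++ (h *P g))             ≈⟨ weightedSum-++ w (shift b e g) (h *P g) ⟩
    weightedSum w (shift b e g) + weightedSum w (h *P g) ≈⟨ +-cong (weightedSum-shift w b e g)
                                                                   (weightedSum-*P-vanishes w g g⊥ h) ⟩
    b * weightedSum _ g + 0#                            ≈⟨ +-identityʳ _ ⟩
    b * weightedSum _ g                                 ≈⟨ *-congˡ (g⊥ e) ⟩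
    b * 0#                                              ≈⟨ zeroʳ b ⟩
    0#                                                  ∎

  module _ {n g} (G : Pol n → Set g) where

    weightedSum-InIdeal : ∀ w → (∀ {q} → G q → ∀ e → weightedSum (λ f → w (e +ₑ f)) q ≈ 0#) →
                          ∀ {p} → InIdeal G p → weightedSum w p ≈ 0#
    weightedSum-InIdeal w G⊥ {p} (cs , p≈cs) = trans (weightedSum-resp-≈P w {p} {combo cs} p≈cs) (vanish cs)
      where
      vanish : ∀ cs → weightedSum w (combo {G = G} cs) ≈ 0#
      vanish []                     = refl
      vanish ((h , (q , Gq)) ∷ cs) = begin
        weightedSum w ((h *P q) ++ combo cs)             ≈⟨ weightedSum-++ w (h *P q) (combo cs) ⟩
        weightedSum w (h *P q) + weightedSum w (combo cs) ≈⟨ +-cong (weightedSum-*P-vanishes w q (G⊥ Gq) h)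
                                                                    (vanish cs) ⟩
        0# + 0#                                           ≈⟨ +-identityˡ 0# ⟩
        0#                                                ∎

    InIdeal-resp-≈P : ∀ p q → p ≈P q → InIdeal G q → InIdeal G p
    InIdeal-resp-≈P p q p≈q (cs , q≈cs) = cs , λ m → trans (p≈q m) (q≈cs m)

    InIdeal-[] : InIdeal G []
    InIdeal-[] = [] , λ m → refl

    InIdeal-++ : ∀ p q → InIdeal G p → InIdeal G q → InIdeal G (p ++ q)
    InIdeal-++ p q (cs , p≈cs) (ds , q≈ds) = cs ++ ds , λ m →
      trans (++-congP p (combo cs) q (combo ds) p≈cs q≈ds m) (≡⇒≈P (combo-++ cs ds) m)
      where
      combo-++ : ∀ cs ds → combo {G = G} cs ++ combo ds ≡ combo (cs ++ ds)
      combo-++ []                    ds = ≡.refl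
      combo-++ ((h , (q , _)) ∷ cs) ds = ≡.trans (++-assoc (h *P q) _ _) (≡.cong ((h *P q) ++_) (combo-++ cs ds))

    InIdeal-multiple : ∀ {q} → G q → ∀ h → InIdeal G (h *P q)
    InIdeal-multiple {q} Gq h = ((h , (q , Gq)) ∷ []) , ≡⇒≈P (≡.sym (++-identityʳ (h *P q)))

    InIdeal-shift : ∀ {q} → G q → ∀ b e → InIdeal G (shift b e q)
    InIdeal-shift {q} Gq b e = InIdeal-resp-≈P (shift b e q) (((b , e) ∷ []) *P q)
      (≡⇒≈P (≡.sym (++-identityʳ (shift b e q)))) (InIdeal-multiple Gq ((b , e) ∷ []))

    record CongruentMod (E F : Monomial n) : Set (c ⊔ ℓ ⊔ g) where
      constructor mk≡
      field binomial∈ : ∀ a → InIdeal G (binomial a E F)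
    open CongruentMod public

    CongruentMod-refl : ∀ {E} → CongruentMod E E
    CongruentMod-refl {E} = mk≡ λ a → InIdeal-resp-≈P (binomial a E E) [] (binomial-refl a E) InIdeal-[]

    CongruentMod-sym : ∀ {E F} → CongruentMod E F → CongruentMod F E
    CongruentMod-sym {E} {F} (mk≡ E≡F) = mk≡ λ a →
      InIdeal-resp-≈P (binomial a F E) (binomial (- a) E F) (binomial-swap a E F) (E≡F (- a))

    CongruentMod-trans : ∀ {E F H} → CongruentMod E F → CongruentMod F H → CongruentMod E H
    CongruentMod-trans {E} {F} {H} (mk≡ E≡F) (mk≡ F≡H) = mk≡ λ a →
      InIdeal-resp-≈P (binomial a E H) (binomial a E F ++ binomial a F H) (binomial-trans a E F H)
        (InIdeal-++ (binomial a E F) (binomial a F H) (E≡F a) (F≡H a))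

    CongruentMod-generator : ∀ {E F} → G (binomial 1# E F) → ∀ e → CongruentMod (e +ₑ E) (e +ₑ F)
    CongruentMod-generator {E} {F} G[E-F] e = mk≡ λ a →
      InIdeal-resp-≈P (binomial a (e +ₑ E) (e +ₑ F)) (shift a e (binomial 1# E F))
        (λ m → trans (binomial-congˡ {E = e +ₑ E} {e +ₑ F} (sym (*-identityʳ a)) m)
                     (sym (shift-binomial a 1# e E F m)))
        (InIdeal-shift G[E-F] a e)

  InIdeal-renameexponents : ∀ {n n′ g g′} {G : Pol n → Set g} (G′ : Pol n′ → Set g′)
                            (ρ : Monomial n → Monomial n′) →
                            (∀ {q} → G q → ∀ h → InIdeal G′ (renameexponents ρ (h *P q))) →
                            ∀ {p} → InIdeal G p → InIdeal G′ (renameexponents ρ p)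
  InIdeal-renameexponents {G = G} G′ ρ G⇒G′ {p} (cs , p≈cs) =
    InIdeal-resp-≈P G′ (renameexponents ρ p) (renameexponents ρ (combo cs))
      (renameexponents-resp-≈P ρ {p} {combo cs} p≈cs) (go cs)
    where
    go : ∀ cs → InIdeal G′ (renameexponents ρ (combo {G = G} cs))
    go []                     = InIdeal-[] G′
    go ((h , (q , Gq)) ∷ cs) = ≡.subst (InIdeal G′) (≡.sym (map-++ (map₂ ρ) (h *P q) (combo cs)))
      (InIdeal-++ G′ (renameexponents ρ (h *P q)) (renameexponents ρ (combo cs)) (G⇒G′ Gq h) (go cs))

module NetworkIdeals {c ℓ} (K : CommutativeRing c ℓ) (N : ℕ) {r : ℕ} (s : Vec ℕ r) where
  open CommutativeRing K
  open Poly K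
  open PolynomialAlgebra K
  open ModularCongruence N

  -- Index zero of a monomial of K[t, x] is the exponent of t; deg is the degree of
  -- its image under t ↦ t, xᵢ ↦ t^sᵢ.
  deg : Monomial (suc r) → ℕ
  deg (k ∷ e) = k ℕ.+ dot e s

  deg-+ₑ : ∀ E F → deg (E +ₑ F) ≡ deg E ℕ.+ deg F
  deg-+ₑ (k ∷ e) (l ∷ f) =
    ≡.trans (≡.cong (k ℕ.+ l ℕ.+_) (dot-+ₑ e f s)) (+-interchange k l (dot e s) (dot f s))
    where open import Algebra.Properties.CommutativeSemigroup ℕP.+-commutativeSemigroup
            renaming (interchange to +-interchange)

  Ĩ : Pol (suc r) → Set c
  Ĩ = TildeGen N s

  infix 4 _∼_
  _∼_ : Monomial (suc r) → Monomial (suc r) → Set (c ⊔ ℓ)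
  _∼_ = CongruentMod Ĩ

  TildeGen-binomial : ∀ {q} → Ĩ q → ∃[ E ] ∃[ F ] (q ≡ binomial 1# E F × deg E ≋ deg F)
  TildeGen-binomial (inj₁ ≡.refl)       = (N ∷ zeros) , (0 ∷ zeros) , ≡.refl , N+-≋ (dot zeros s)
  TildeGen-binomial (inj₂ (i , ≡.refl)) = (lookup s i ∷ zeros) , (0 ∷ unit i) , ≡.refl ,
    ≋-reflexive (≡.trans (≡.cong (lookup s i ℕ.+_) (dot-zeros s))
                         (≡.trans (ℕP.+-identityʳ _) (≡.sym (dot-unit i s))))

  generator-step : ∀ k e i → (k ∷ increment e i) ∼ ((k ℕ.+ lookup s i) ∷ e)
  generator-step k e i =
    ≡.subst₂ _∼_ (≡.cong₂ _∷_ (ℕP.+-identityʳ k) (+ₑ-unit e i)) (≡.cong (_ ∷_) (+ₑ-zeros e))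
    (CongruentMod-sym Ĩ (CongruentMod-generator Ĩ (inj₂ (i , ≡.refl)) (k ∷ e)))

  t-period : ∀ k → ((k ℕ.+ N) ∷ zeros) ∼ (k ∷ zeros)
  t-period k =
    ≡.subst₂ _∼_ (≡.cong (_ ∷_) (+ₑ-zeros zeros)) (≡.cong₂ _∷_ (ℕP.+-identityʳ k) (+ₑ-zeros zeros))
    (CongruentMod-generator Ĩ (inj₁ ≡.refl) (k ∷ zeros))

  reduce : ∀ k {e} → Increments e → (k ∷ e) ∼ ((k ℕ.+ dot e s) ∷ zeros)
  reduce k none = ≡.subst (λ d → (k ∷ zeros) ∼ (d ∷ zeros))
    (≡.sym (≡.trans (≡.cong (k ℕ.+_) (dot-zeros s)) (ℕP.+-identityʳ k))) (CongruentMod-refl Ĩ)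
  reduce k (more {e} p i) = CongruentMod-trans Ĩ (generator-step k e i)
    (≡.subst (λ d → ((k ℕ.+ lookup s i) ∷ e) ∼ (d ∷ zeros)) deg≡ (reduce (k ℕ.+ lookup s i) p))
    where
    deg≡ : k ℕ.+ lookup s i ℕ.+ dot e s ≡ k ℕ.+ dot (increment e i) s
    deg≡ = ≡.trans (ℕP.+-assoc k _ _) (≡.cong (k ℕ.+_) (≡.sym (dot-increment e i s)))

  ∼t^deg : ∀ E → E ∼ (deg E ∷ zeros)
  ∼t^deg (k ∷ e) = reduce k (increments e)

  t-periodic : ∀ q y → ((y ℕ.+ q ℕ.* N) ∷ zeros) ∼ (y ∷ zeros)
  t-periodic zero    y =
    ≡.subst (λ d → (d ∷ zeros) ∼ (y ∷ zeros)) (≡.sym (ℕP.+-identityʳ y)) (CongruentMod-refl Ĩ)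
  t-periodic (suc q) y = ≡.subst (λ d → (d ∷ zeros) ∼ (y ∷ zeros)) shuffle
    (CongruentMod-trans Ĩ (t-period (y ℕ.+ q ℕ.* N)) (t-periodic q y))
    where
    shuffle : y ℕ.+ q ℕ.* N ℕ.+ N ≡ y ℕ.+ suc q ℕ.* N
    shuffle = ≡.trans (ℕP.+-assoc y _ N) (≡.cong (y ℕ.+_) (ℕP.+-comm (q ℕ.* N) N))

  t-congruent : ∀ {x y} → x ≋ y → (x ∷ zeros) ∼ (y ∷ zeros)
  t-congruent {x} {y} x≋y with ℕP.≤-total y x
  ... | inj₁ y≤x = let q , x≡ = ≋⇒≡+*N y≤x x≋y in
    ≡.subst (λ d → (d ∷ zeros) ∼ (y ∷ zeros)) (≡.sym x≡) (t-periodic q y)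
  ... | inj₂ x≤y = let q , y≡ = ≋⇒≡+*N x≤y (≋-sym x≋y) in
    CongruentMod-sym Ĩ (≡.subst (λ d → (d ∷ zeros) ∼ (x ∷ zeros)) (≡.sym y≡) (t-periodic q x))

  ≋⇒∼ : ∀ {E F} → deg E ≋ deg F → E ∼ F
  ≋⇒∼ {E} {F} E≋F =
    CongruentMod-trans Ĩ (∼t^deg E) (CongruentMod-trans Ĩ (t-congruent E≋F) (CongruentMod-sym Ĩ (∼t^deg F)))

  InLattice⇒≋ : ∀ {a} → InLattice N s a → dot (Vec.map pos a) s ≋ dot (Vec.map neg a) s
  InLattice⇒≋ {a} N∣a·s =
    mk≋ (≡.subst (+ N ℤS.∣_) (dotℤ-pos-neg a s) (ℤS.∣ᵤ⇒∣ {+ N} {dotℤ a s} N∣a·s))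

  latticeMultiple∈Ĩ : ∀ {q} → LatticeGen N s q → ∀ h → InIdeal Ĩ (embed (h *P q))
  latticeMultiple∈Ĩ             _                  []            = InIdeal-[] Ĩ
  latticeMultiple∈Ĩ {q} L[q]@(a , a∈L , ≡.refl) ((b , d) ∷ h) =
    ≡.subst (InIdeal Ĩ) (≡.sym (map-++ (map₂ (0 ∷_)) (shift b d q) (h *P q)))
      (InIdeal-++ Ĩ (embed (shift b d q)) (embed (h *P q))
        (InIdeal-resp-≈P Ĩ (embed (shift b d q)) (binomial (b * 1#) (0 ∷ d +ₑ P) (0 ∷ d +ₑ Q))
          (renameexponents-resp-≈P (0 ∷_) {shift b d q} {binomial (b * 1#) (d +ₑ P) (d +ₑ Q)}
            (shift-binomial b 1# d P Q))
          (binomial∈ (≋⇒∼ d+P≋d+Q) (b * 1#)))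
        (latticeMultiple∈Ĩ L[q] h))
    where
    P = Vec.map pos a
    Q = Vec.map neg a
    d+P≋d+Q : dot (d +ₑ P) s ≋ dot (d +ₑ Q) s
    d+P≋d+Q = ≡.subst₂ _≋_ (≡.sym (dot-+ₑ d P s)) (≡.sym (dot-+ₑ d Q s))
                (+-congˡ-≋ (dot d s) (InLattice⇒≋ {a} a∈L))

  fromLattice⇒fromĨ : ∀ f → InIdeal (LatticeGen N s) f → InIdeal Ĩ (embed f)
  fromLattice⇒fromĨ f = InIdeal-renameexponents Ĩ (0 ∷_) latticeMultiple∈Ĩ {f}

  DegreeInvariant : (Monomial (suc r) → Carrier) → Set ℓ
  DegreeInvariant w = ∀ E F → deg E ≋ deg F → w E ≈ w F

  weightedSum-Ĩ : ∀ w → DegreeInvariant w → ∀ {p} → InIdeal Ĩ p → weightedSum w p ≈ 0#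
  weightedSum-Ĩ w w-inv {p} = weightedSum-InIdeal Ĩ w generator⊥ {p}
    where
    generator⊥ : ∀ {q} → Ĩ q → ∀ e → weightedSum (λ f → w (e +ₑ f)) q ≈ 0#
    generator⊥ Ĩq e with TildeGen-binomial Ĩq
    ... | E , F , ≡.refl , E≋F = begin
      weightedSum _ (binomial 1# E F)           ≈⟨ weightedSum-binomial _ 1# E F ⟩
      1# * w (e +ₑ E) - 1# * w (e +ₑ F)         ≈⟨ +-congˡ (-‿cong (*-congˡ (w-inv _ _ e+E≋e+F))) ⟨
      1# * w (e +ₑ E) - 1# * w (e +ₑ E)         ≈⟨ -‿inverseʳ _ ⟩
      0#                                        ∎
      where
      open import Relation.Binary.Reasoning.Setoid setoid
      e+E≋e+F : deg (e +ₑ E) ≋ deg (e +ₑ F)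
      e+E≋e+F = ≡.subst₂ _≋_ (≡.sym (deg-+ₑ e E)) (≡.sym (deg-+ₑ e F)) (+-congˡ-≋ (deg e) E≋F)

  classIndicator : ℕ → Monomial (suc r) → Carrier
  classIndicator d E = 𝟙 (deg E ≋? d)

  classIndicator-invariant : ∀ d → DegreeInvariant (classIndicator d)
  classIndicator-invariant d E F E≋F =
    𝟙-cong (deg E ≋? d) (deg F ≋? d) (≋-trans (≋-sym E≋F)) (≋-trans E≋F)

  ≋⇒InLattice-diffₑ : ∀ {e f} → dot e s ≋ dot f s → InLattice N s (diffₑ e f)
  ≋⇒InLattice-diffₑ {e} {f} (mk≋ N∣e-f) =
    ≡.subst (λ z → N ℕD.∣ ℤ.∣ z ∣) (≡.sym (dotℤ-diffₑ e f s)) (ℤS.∣⇒∣ᵤ N∣e-f)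

  latticeGenerator : ∀ e f → dot e s ≋ dot f s → Σ (Pol r) (LatticeGen N s)
  latticeGenerator e f e≋f = binomial 1# (Vec.map pos (diffₑ e f)) (Vec.map neg (diffₑ e f)) ,
                             diffₑ e f , ≋⇒InLattice-diffₑ {e} {f} e≋f , ≡.refl

  binomial≈latticeMultiple : ∀ a (e f : Monomial r) →
    binomial a e f ≈P shift a (gcdₑ e f) (binomial 1# (Vec.map pos (diffₑ e f)) (Vec.map neg (diffₑ e f)))
  binomial≈latticeMultiple a e f m = begin
    coeff (binomial a e f) m                        ≈⟨ binomial-congˡ {E = e} {f} (sym (*-identityʳ a)) m ⟩
    coeff (binomial (a * 1#) e f) m                 ≡⟨ ≡.cong₂ (λ E F → coeff (binomial (a * 1#) E F) m)
                                                          (gcdₑ-+ₑ-pos e f) (gcdₑ-+ₑ-neg e f) ⟨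
    coeff (binomial (a * 1#) (G +ₑ P) (G +ₑ Q)) m   ≈⟨ shift-binomial a 1# G P Q m ⟨
    coeff (shift a G (binomial 1# P Q)) m           ∎
    where
    open import Relation.Binary.Reasoning.Setoid setoid
    G = gcdₑ e f
    P = Vec.map pos (diffₑ e f)
    Q = Vec.map neg (diffₑ e f)

  open Representatives (On.decSetoid ≋-decSetoid (λ e → dot e s)) using (rep; rep-≈; rep-resp)

  latticeReduction : List (Monomial r) → Pol r → List (Pol r × Σ (Pol r) (LatticeGen N s))
  latticeReduction L []            = []
  latticeReduction L ((a , e) ∷ p) =
    (((a , gcdₑ e (rep L e)) ∷ []) , latticeGenerator e (rep L e) (rep-≈ L e)) ∷ latticeReduction L p

  -- Each term a x^e is a x^(rep e) plus a multiple of a lattice binomial.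
  ≈latticeReduction+representatives : ∀ L p → p ≈P (combo (latticeReduction L p) ++ renameexponents (rep L) p)
  ≈latticeReduction+representatives L []            m = refl
  ≈latticeReduction+representatives L ((a , e) ∷ p) = begin
    ((a , e) ∷ []) ++ p     ≈⟨ ++-congP ((a , e) ∷ []) (B ++ T) p (C ++ R)
                                 (term≈binomial+term a e ρ) (≈latticeReduction+representatives L p) ⟩
    (B ++ T) ++ (C ++ R)    ≈⟨ interchange B T C R ⟩
    (B ++ C) ++ (T ++ R)    ≈⟨ ++-congP (B ++ C) (X ++ C) (T ++ R) (T ++ R)
                                 (++-congP B X C C B≈X (λ _ → refl)) (λ _ → refl) ⟩
    (X ++ C) ++ (T ++ R)    ∎
    where
    module M = CommutativeMonoid (++-commutativeMonoid r)
    open import Algebra.Properties.CommutativeSemigroup M.commutativeSemigroup using (interchange)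
    open import Relation.Binary.Reasoning.Setoid M.setoid
    ρ = rep L e
    B = binomial a e ρ
    T = (a , ρ) ∷ []
    S = shift a (gcdₑ e ρ) (binomial 1# (Vec.map pos (diffₑ e ρ)) (Vec.map neg (diffₑ e ρ)))
    X = S ++ []
    C = combo (latticeReduction L p)
    R = renameexponents (rep L) p
    B≈X : B ≈P X
    B≈X m = trans (binomial≈latticeMultiple a e ρ m) (sym (M.identityʳ S m))

  module _ (f : Pol r) (classSums≈0 : ∀ d → weightedSum (classIndicator d) (embed f) ≈ 0#) where
    open import Relation.Binary.Reasoning.Setoid setoid

    private
      L = exponents f

      coeff-rename : ∀ m → coeff (renameexponents (rep L) f) m ≈ weightedSum (λ e → 𝟙 (rep L e ≟ₘ m)) f
      coeff-rename m = trans (coeff≈weightedSum (renameexponents (rep L) f) m)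
                             (reflexive (weightedSum-renameexponents _ (rep L) f))

      covered : All (λ t → Any (λ e′ → dot (proj₂ t) s ≋ dot e′ s) L) f
      covered = All.tabulate λ t∈f → Any.map (λ { ≡.refl → ≋-refl }) (∈-map⁺ proj₂ t∈f)

      rep≡⇒≋ : ∀ {e m} → rep L e ≡ m → dot e s ≋ dot m s
      rep≡⇒≋ {e} ≡.refl = rep-≈ L e

    representatives-vanish : renameexponents (rep L) f ≈P []
    representatives-vanish m with rep L m ≟ₘ m
    ... | yes rep[m]≡m = begin
      coeff (renameexponents (rep L) f) m               ≈⟨ coeff-rename m ⟩
      weightedSum (λ e → 𝟙 (rep L e ≟ₘ m)) f            ≈⟨ weightedSum-congˡ f (All.map sameClass covered) ⟩
      weightedSum (classIndicator (dot m s) ∘ (0 ∷_)) f  ≡⟨ weightedSum-renameexponents _ (0 ∷_) f ⟨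
      weightedSum (classIndicator (dot m s)) (embed f)  ≈⟨ classSums≈0 (dot m s) ⟩
      0#                                                ∎
      where
      sameClass : ∀ {e} → Any (λ e′ → dot e s ≋ dot e′ s) L →
                  𝟙 (rep L e ≟ₘ m) ≈ classIndicator (dot m s) (0 ∷ e)
      sameClass {e} e∈L = 𝟙-cong (rep L e ≟ₘ m) (dot e s ≋? dot m s) rep≡⇒≋
        (λ e≋m → ≡.trans (rep-resp L e∈L e≋m) rep[m]≡m)
    ... | no rep[m]≢m = begin
      coeff (renameexponents (rep L) f) m               ≈⟨ coeff-rename m ⟩
      weightedSum (λ e → 𝟙 (rep L e ≟ₘ m)) f            ≈⟨ weightedSum-congˡ f (All.map notRep covered) ⟩
      weightedSum (λ _ → 0#) f                          ≈⟨ weightedSum-zero f ⟩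
      0#                                                ∎
      where
      notRep : ∀ {e} → Any (λ e′ → dot e s ≋ dot e′ s) L → 𝟙 (rep L e ≟ₘ m) ≈ 0#
      notRep {e} e∈L = 𝟙-no (rep L e ≟ₘ m) λ rep[e]≡m →
        rep[m]≢m (≡.trans (≡.sym (rep-resp L e∈L (rep≡⇒≋ rep[e]≡m))) rep[e]≡m)

  fromĨ⇒fromLattice : ∀ f → InIdeal Ĩ (embed f) → InIdeal (LatticeGen N s) f
  fromĨ⇒fromLattice f embed[f]∈Ĩ = latticeReduction L f , λ m → begin
    coeff f m                                         ≈⟨ ≈latticeReduction+representatives L f m ⟩
    coeff (combo (latticeReduction L f) ++ R) m       ≈⟨ coeff-++ (combo (latticeReduction L f)) R m ⟩
    coeff (combo (latticeReduction L f)) m + coeff R m ≈⟨ +-congˡ (representatives-vanish f classSums≈0 m) ⟩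
    coeff (combo (latticeReduction L f)) m + 0#       ≈⟨ +-identityʳ _ ⟩
    coeff (combo (latticeReduction L f)) m            ∎
    where
    open import Relation.Binary.Reasoning.Setoid setoid
    L = exponents f
    R = renameexponents (rep L) f
    classSums≈0 : ∀ d → weightedSum (classIndicator d) (embed f) ≈ 0#
    classSums≈0 d = weightedSum-Ĩ (classIndicator d) (classIndicator-invariant d) {embed f} embed[f]∈Ĩ

theorem3p6 : ∀ {c ℓ} (K : CommutativeRing c ℓ) → IsField K →
    (r N : ℕ) → 1 ≤ N → (s : Vec ℕ r) →
    (f : Poly.Pol K r) →
    Poly.InIdeal K (Poly.LatticeGen K N s) f ⇔ Poly.InIdeal K (Poly.TildeGen K N s) (Poly.embed K f)
theorem3p6 K _ r N _ s f = mk⇔ (fromLattice⇒fromĨ f) (fromĨ⇒fromLattice f)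
  where open NetworkIdeals K N s
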